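{- Let $t$ be the Thue–Morse word. The only privileged factors of $t$ that begin with the letter $0$ and are not primitive are $00$, $010010$, $01100110$, and $(011010010110)^2$.
   Context: The Thue–Morse word $t$ is the fixed point beginning with $0$ of the morphism $0\mapsto01,\ 1\mapsto10$. A nonempty word is primitive if it is not of the form $v^k$ with $k\ge2$. A complete first return to a word $v$ is a word that begins with $v$, ends with $v$, and contains exactly two occurrences of $v$. Privileged words: the empty word and every letter are privileged, and a word is privileged if it is a complete first return to a shorter privileged word. -}

module Defs where

open import Data.Bool using (Bool; true; false; not; if_then_else_)
open import Data.Nat using (ℕ; zero; suc; _+_; _<_; _≤_)
open import Data.List using (List; []; _∷_; _++_; map; concatMap; length; upTo; concat; replicate)
open import Data.Product using (Σ; ∃; _×_; _,_)
open import Relation.Nullary using (¬_; does)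
open import Relation.Binary.PropositionalEquality using (_≡_)

Word : Set
Word = List Bool

𝟎 𝟏 : Bool
𝟎 = false
𝟏 = true

μ : Word → Word
μ = concatMap (λ a → a ∷ not a ∷ [])

μ^ : ℕ → Word
μ^ zero    = 𝟎 ∷ []
μ^ (suc k) = μ (μ^ k)

-- n-th letter of a word (0-indexed), with a default for out-of-range indices
nth : Word → ℕ → Bool
nth []      _       = 𝟎
nth (a ∷ w) zero    = a
nth (a ∷ w) (suc n) = nth w n

-- The Thue–Morse word t = lim μ^k(0): its n-th letter is the n-th letter of
-- μ^(n+1)(0), which has length 2^(n+1) > n (and μ^k(0) is a prefix of μ^(k+1)(0)).
t : ℕ → Bool
t n = nth (μ^ (suc n)) n

Factor : Word → Set
Factor w = ∃ λ i → w ≡ map (λ j → t (i + j)) (upTo (length w))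

Primitive : Word → Set
Primitive w = ¬ (w ≡ []) × (¬ ∃ λ v → ∃ λ k → 2 ≤ k × w ≡ concat (replicate k v))

_≟b_ : Bool → Bool → Bool
false ≟b false = true
true  ≟b true  = true
_     ≟b _     = false

isPrefix : Word → Word → Bool
isPrefix []      _       = true
isPrefix (a ∷ v) []      = false
isPrefix (a ∷ v) (b ∷ w) = if a ≟b b then isPrefix v w else false

-- Number of occurrences of v in w (positions 0..|w| at which v starts).
occ : Word → Word → ℕ
occ v []      = if isPrefix v [] then 1 else 0
occ v (a ∷ w) = (if isPrefix v (a ∷ w) then 1 else 0) + occ v w

CompleteFirstReturn : Word → Word → Set
CompleteFirstReturn v w =
  (∃ λ u → w ≡ v ++ u) × (∃ λ u → w ≡ u ++ v) × occ v w ≡ 2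

data Privileged : Word → Set where
  priv-empty  : Privileged []
  priv-letter : (a : Bool) → Privileged (a ∷ [])
  priv-return : ∀ {v w} → Privileged v → length v < length w →
                CompleteFirstReturn v w → Privileged w

_² : Word → Word
w ² = w ++ w

-- A non-primitive factor w = vᵏ (k ≥ 2) of t has a period |v| dividing |w|. If w is privileged, it is a
-- complete first return to a privileged border u, so d = |w| − |u| is a period of w, and the least one:
-- a shorter period would produce a third occurrence of u. By Fine and Wilf, d divides |v|, so w = yᵐ with
-- |y| = d. For m = 2, y = u is the root of a privileged square. For m ≥ 3 the border y^(m−1) is again a
-- privileged power, so by recursion d is at most the length of a root of a privileged square, and then the
-- cube y³ inside w contradicts a finite check.
-- The roots of privileged squares are found by induction: the border of such a root is one too, and a
-- complete first return to a given word u is no longer than the largest gap between occurrences of u in t.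
-- The remaining finite facts about factors of t of bounded length are decided by computation.

module Submission where

open import Defs
open import Data.Bool using (Bool; true; false; not; _xor_; T)
import Data.Bool.Properties as 𝔹
open import Data.Empty using (⊥-elim)
open import Data.List using (List; []; _∷_; _++_; map; take; drop; length; upTo; applyUpTo; concat; replicate)
open import Data.List.Properties using (length-++; length-map; concatMap-++; map-applyUpTo; ≡-dec; ++-assoc; ++-identityʳ)
open import Data.List.Membership.Propositional using (_∈_; find)
open import Data.List.Membership.Propositional.Properties using (∈-upTo⁺; ∈-applyUpTo⁻)
open import Data.List.Membership.DecPropositional (≡-dec 𝔹._≟_) using (_∈?_)
open import Data.List.Relation.Unary.All using (All; all?; lookup)
open import Data.List.Relation.Unary.Any using (Any; any?; here; there)
open import Data.Nat using (ℕ; zero; suc; _+_; _*_; _∸_; _^_; _≤_; _<_; z≤n; s≤s; NonZero; >-nonZero)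
open import Data.Nat.Properties
open import Data.Nat.DivMod using (_/_; _%_; m≡m%n+[m/n]*n; m%n<n)
open import Data.Nat.Divisibility using (_∣_; divides; ∣-refl; ∣-trans; ∣⇒≤; ∣m∸n∣n⇒∣m; ∣m+n∣m⇒∣n)
open import Data.Nat.Induction using (<-wellFounded)
open import Data.Nat.Solver using (module +-*-Solver)
open import Data.Product using (∃; ∃₂; ∄; _×_; _,_; map₂)
open import Data.Sum using (_⊎_; inj₁; inj₂)
open import Function.Bundles using (_⇔_; mk⇔)
open import Induction.WellFounded using (Acc; acc)
open import Relation.Binary.Definitions using (DecidableEquality; Tri; tri<; tri≈; tri>)
open import Relation.Binary.PropositionalEquality
open import Relation.Nullary using (¬_)
open import Relation.Nullary.Decidable using (Dec; yes; no; True; toWitness; _→-dec_; _⊎-dec_; ¬?; T?; decidable-stable)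
open import Relation.Unary using (Decidable)

open +-*-Solver

2^-suc : ∀ k → 2 ^ suc k ≡ 2 ^ k + 2 ^ k
2^-suc k = cong (2 ^ k +_) (+-identityʳ (2 ^ k))

n<2^n : ∀ n → n < 2 ^ n
n<2^n zero    = s≤s z≤n
n<2^n (suc n) = subst (suc n <_) (sym (2^-suc n)) (+-mono-≤ (m^n>0 2 n) (n<2^n n))

n<2^1+n : ∀ n → n < 2 ^ suc n
n<2^1+n n = <-trans (n<1+n n) (n<2^n (suc n))

double-< : ∀ k {m} → m < 2 ^ k → m + m < 2 ^ suc k
double-< k {m} m<2^k = subst (m + m <_) (sym (2^-suc k)) (+-mono-< m<2^k m<2^k)

double-suc-< : ∀ k {m} → m < 2 ^ k → suc (m + m) < 2 ^ suc k
double-suc-< k {m} m<2^k =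
  subst (_≤ 2 ^ suc k) (cong suc (+-suc m m)) (subst (suc m + suc m ≤_) (sym (2^-suc k)) (+-mono-≤ m<2^k m<2^k))

half-< : ∀ k {m} → m + m < 2 ^ suc k → m < 2 ^ k
half-< k {m} h = ≰⇒> λ 2^k≤m → <⇒≱ h (subst (_≤ m + m) (sym (2^-suc k)) (+-mono-≤ 2^k≤m 2^k≤m))

half-suc-< : ∀ k {m} → suc (m + m) < 2 ^ suc k → m < 2 ^ k
half-suc-< k h = half-< k (<-trans (n<1+n _) h)

data EvenOdd : ℕ → Set where
  even : ∀ m → EvenOdd (m + m)
  odd  : ∀ m → EvenOdd (suc (m + m))

evenOdd : ∀ n → EvenOdd n
evenOdd zero = even 0
evenOdd (suc n) with evenOdd n
... | even m = odd m
... | odd m  = subst EvenOdd (cong suc (+-suc m m)) (even (suc m))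

m+m≤n+n⇒m≤n : ∀ {m n} → m + m ≤ n + n → m ≤ n
m+m≤n+n⇒m≤n {m} {n} le = ≮⇒≥ λ n<m → <⇒≱ (+-mono-< n<m n<m) le

m∣n∧m<n⇒m+m≤n : ∀ {m n} → m ∣ n → m < n → m + m ≤ n
m∣n∧m<n⇒m+m≤n {m} (divides zero          refl) ()
m∣n∧m<n⇒m+m≤n {m} (divides (suc zero)    refl) m<m = ⊥-elim (<-irrefl (sym (+-identityʳ m)) m<m)
m∣n∧m<n⇒m+m≤n {m} (divides (suc (suc q)) refl) _   = +-monoʳ-≤ m (m≤m+n m (q * m))

i+[j+p]≡i+p+j : ∀ i j p → i + (j + p) ≡ i + p + j
i+[j+p]≡i+p+j i j p = solve 3 (λ i j p → i :+ (j :+ p) := i :+ p :+ j) refl i j p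

nth-++ˡ : ∀ (u v : Word) {j} → j < length u → nth (u ++ v) j ≡ nth u j
nth-++ˡ (a ∷ u) v {zero}  _         = refl
nth-++ˡ (a ∷ u) v {suc j} (s≤s j<u) = nth-++ˡ u v j<u

nth-++ʳ : ∀ (u v : Word) j → nth (u ++ v) (length u + j) ≡ nth v j
nth-++ʳ []      v j = refl
nth-++ʳ (a ∷ u) v j = nth-++ʳ u v j

nth-map : ∀ f (w : Word) {j} → j < length w → nth (map f w) j ≡ f (nth w j)
nth-map f (a ∷ w) {zero}  _         = refl
nth-map f (a ∷ w) {suc j} (s≤s j<w) = nth-map f w j<w

drop≡nth∷drop : ∀ (w : Word) {r} → r < length w → drop r w ≡ nth w r ∷ drop (suc r) w
drop≡nth∷drop (a ∷ w) {zero}  _         = refl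
drop≡nth∷drop (a ∷ w) {suc r} (s≤s r<w) = drop≡nth∷drop w r<w

take-length-++ : ∀ (u v : Word) → take (length u) (u ++ v) ≡ u
take-length-++ []      v = refl
take-length-++ (a ∷ u) v = cong (a ∷_) (take-length-++ u v)

drop-length-++ : ∀ (u v : Word) → drop (length u) (u ++ v) ≡ v
drop-length-++ []      v = refl
drop-length-++ (a ∷ u) v = drop-length-++ u v

concat-replicate-comm : ∀ k (v : Word) → concat (replicate k v) ++ v ≡ v ++ concat (replicate k v)
concat-replicate-comm zero    v = sym (++-identityʳ v)
concat-replicate-comm (suc k) v = trans (++-assoc v (concat (replicate k v)) v) (cong (v ++_) (concat-replicate-comm k v))

length-concat-replicate : ∀ k (v : Word) → length (concat (replicate k v)) ≡ k * length v
length-concat-replicate zero    v = refl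
length-concat-replicate (suc k) v = trans (length-++ v) (cong (length v +_) (length-concat-replicate k v))

concat-replicate-[] : ∀ k → concat (replicate k ([] {A = Bool})) ≡ []
concat-replicate-[] zero    = refl
concat-replicate-[] (suc k) = concat-replicate-[] k

_≟ʷ_ : DecidableEquality Word
_≟ʷ_ = ≡-dec 𝔹._≟_

bits : List Bool
bits = 𝟎 ∷ 𝟏 ∷ []

∈-bits : ∀ a → a ∈ bits
∈-bits false = here refl
∈-bits true  = there (here refl)

-- The Thue–Morse word

μ-map-not : ∀ w → μ (map not w) ≡ map not (μ w)
μ-map-not []      = refl
μ-map-not (a ∷ w) = cong (λ v → not a ∷ not (not a) ∷ v) (μ-map-not w)

μ^-suc : ∀ k → μ^ (suc k) ≡ μ^ k ++ map not (μ^ k)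
μ^-suc zero    = refl
μ^-suc (suc k) = begin
  μ (μ^ (suc k))                       ≡⟨ cong μ (μ^-suc k) ⟩
  μ (μ^ k ++ map not (μ^ k))           ≡⟨ concatMap-++ _ (μ^ k) (map not (μ^ k)) ⟩
  μ^ (suc k) ++ μ (map not (μ^ k))     ≡⟨ cong (μ^ (suc k) ++_) (μ-map-not (μ^ k)) ⟩
  μ^ (suc k) ++ map not (μ^ (suc k))   ∎
  where open ≡-Reasoning

length-μ^ : ∀ k → length (μ^ k) ≡ 2 ^ k
length-μ^ zero    = refl
length-μ^ (suc k) = begin
  length (μ^ (suc k))                      ≡⟨ cong length (μ^-suc k) ⟩
  length (μ^ k ++ map not (μ^ k))          ≡⟨ length-++ (μ^ k) ⟩
  length (μ^ k) + length (map not (μ^ k))  ≡⟨ cong (length (μ^ k) +_) (length-map not (μ^ k)) ⟩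
  length (μ^ k) + length (μ^ k)            ≡⟨ cong₂ _+_ (length-μ^ k) (length-μ^ k) ⟩
  2 ^ k + 2 ^ k                            ≡⟨ 2^-suc k ⟨
  2 ^ suc k                                ∎
  where open ≡-Reasoning

nth-μ-even : ∀ w n → nth (μ w) (n + n) ≡ nth w n
nth-μ-even []      zero    = refl
nth-μ-even []      (suc n) = refl
nth-μ-even (a ∷ w) zero    = refl
nth-μ-even (a ∷ w) (suc n) rewrite +-suc n n = nth-μ-even w n

nth-μ-odd : ∀ w {n} → n < length w → nth (μ w) (suc (n + n)) ≡ not (nth w n)
nth-μ-odd (a ∷ w) {zero}  _         = refl
nth-μ-odd (a ∷ w) {suc n} (s≤s n<w) rewrite +-suc n n = nth-μ-odd w n<w

nth-μ^-suc : ∀ k {n} → n < 2 ^ k → nth (μ^ (suc k)) n ≡ nth (μ^ k) n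
nth-μ^-suc k {n} n<2^k = begin
  nth (μ^ (suc k)) n                ≡⟨ cong (λ w → nth w n) (μ^-suc k) ⟩
  nth (μ^ k ++ map not (μ^ k)) n    ≡⟨ nth-++ˡ (μ^ k) _ (subst (n <_) (sym (length-μ^ k)) n<2^k) ⟩
  nth (μ^ k) n                      ∎
  where open ≡-Reasoning

nth-μ^-+ : ∀ l {k n} → n < 2 ^ k → nth (μ^ (l + k)) n ≡ nth (μ^ k) n
nth-μ^-+ zero    n<2^k = refl
nth-μ^-+ (suc l) {k} n<2^k =
  trans (nth-μ^-suc (l + k) (<-≤-trans n<2^k (^-monoʳ-≤ 2 (m≤n+m k l)))) (nth-μ^-+ l n<2^k)

t≡nth-μ^ : ∀ k {n} → n < 2 ^ k → t n ≡ nth (μ^ k) n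
t≡nth-μ^ k {n} n<2^k = begin
  nth (μ^ (suc n)) n       ≡⟨ nth-μ^-+ k (n<2^1+n n) ⟨
  nth (μ^ (k + suc n)) n   ≡⟨ cong (λ l → nth (μ^ l) n) (+-comm k (suc n)) ⟩
  nth (μ^ (suc n + k)) n   ≡⟨ nth-μ^-+ (suc n) n<2^k ⟩
  nth (μ^ k) n             ∎
  where open ≡-Reasoning

t-double : ∀ n → t (n + n) ≡ t n
t-double n = trans (t≡nth-μ^ (suc (suc n)) (double-< (suc n) (n<2^1+n n))) (nth-μ-even (μ^ (suc n)) n)

t-double-suc : ∀ n → t (suc (n + n)) ≡ not (t n)
t-double-suc n = trans (t≡nth-μ^ (suc (suc n)) (double-suc-< (suc n) (n<2^1+n n)))
  (nth-μ-odd (μ^ (suc n)) (subst (n <_) (sym (length-μ^ (suc n))) (n<2^1+n n)))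

t-block : ∀ k q r → r < 2 ^ k → t (r + q * 2 ^ k) ≡ t q xor t r
t-block zero    q zero _ = trans (cong t (*-identityʳ q)) (sym (𝔹.xor-identityʳ (t q)))
t-block zero    q (suc r) (s≤s ())
t-block (suc k) q r r<2^k+1 with evenOdd r
... | even m = begin
  t (m + m + q * 2 ^ suc k)               ≡⟨ cong t (split (2 ^ k)) ⟩
  t (m + q * 2 ^ k + (m + q * 2 ^ k))     ≡⟨ t-double (m + q * 2 ^ k) ⟩
  t (m + q * 2 ^ k)                       ≡⟨ t-block k q m (half-< k r<2^k+1) ⟩
  t q xor t m                             ≡⟨ cong (t q xor_) (t-double m) ⟨
  t q xor t (m + m)                       ∎
  where
  open ≡-Reasoning
  split : ∀ a → m + m + q * (a + (a + 0)) ≡ m + q * a + (m + q * a)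
  split = solve 3 (λ m q a → m :+ m :+ q :* (a :+ (a :+ con 0)) := m :+ q :* a :+ (m :+ q :* a)) refl m q
... | odd m = begin
  t (suc (m + m) + q * 2 ^ suc k)          ≡⟨ cong t (split (2 ^ k)) ⟩
  t (suc (m + q * 2 ^ k + (m + q * 2 ^ k))) ≡⟨ t-double-suc (m + q * 2 ^ k) ⟩
  not (t (m + q * 2 ^ k))                  ≡⟨ cong not (t-block k q m (half-suc-< k r<2^k+1)) ⟩
  not (t q xor t m)                        ≡⟨ 𝔹.not-distribʳ-xor (t q) (t m) ⟩
  t q xor not (t m)                        ≡⟨ cong (t q xor_) (t-double-suc m) ⟨
  t q xor t (suc (m + m))                  ∎
  where
  open ≡-Reasoning
  split : ∀ a → suc (m + m + q * (a + (a + 0))) ≡ suc (m + q * a + (m + q * a))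
  split = solve 3 (λ m q a → con 1 :+ (m :+ m :+ q :* (a :+ (a :+ con 0))) := con 1 :+ (m :+ q :* a :+ (m :+ q :* a))) refl m q

slice : ℕ → ℕ → Word
slice i zero    = []
slice i (suc n) = t i ∷ slice (suc i) n

applyUpTo≡slice : ∀ {f} i n → (∀ j → f j ≡ t (i + j)) → applyUpTo f n ≡ slice i n
applyUpTo≡slice i zero    f≗t = refl
applyUpTo≡slice i (suc n) f≗t = cong₂ _∷_ (trans (f≗t 0) (cong t (+-identityʳ i)))
  (applyUpTo≡slice (suc i) n (λ j → trans (f≗t (suc j)) (cong t (+-suc i j))))

factor≡slice : ∀ i n → map (λ j → t (i + j)) (upTo n) ≡ slice i n
factor≡slice i n = trans (map-applyUpTo _ _ n) (applyUpTo≡slice i n (λ _ → refl))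

length-slice : ∀ i n → length (slice i n) ≡ n
length-slice i zero    = refl
length-slice i (suc n) = cong suc (length-slice (suc i) n)

nth-slice : ∀ i {n j} → j < n → nth (slice i n) j ≡ t (i + j)
nth-slice i {suc n} {zero}  _         = cong t (sym (+-identityʳ i))
nth-slice i {suc n} {suc j} (s≤s j<n) = trans (nth-slice (suc i) j<n) (cong t (sym (+-suc i j)))

slice-++ : ∀ i a b → slice i (a + b) ≡ slice i a ++ slice (i + a) b
slice-++ i zero    b = cong (λ x → slice x b) (sym (+-identityʳ i))
slice-++ i (suc a) b = cong (t i ∷_)
  (trans (slice-++ (suc i) a b) (cong (λ x → slice (suc i) a ++ slice x b) (sym (+-suc i a))))

slice-² : ∀ {i m} → slice (i + m) m ≡ slice i m → slice i (m + m) ≡ slice i m ²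
slice-² {i} {m} square = trans (slice-++ i m m) (cong (slice i m ++_) square)

take-slice : ∀ i {a n} → a ≤ n → take a (slice i n) ≡ slice i a
take-slice i {zero}          _         = refl
take-slice i {suc a} {suc n} (s≤s a≤n) = cong (t i ∷_) (take-slice (suc i) a≤n)

drop-slice : ∀ i a n → drop a (slice i n) ≡ slice (i + a) (n ∸ a)
drop-slice i zero    n       = cong (λ x → slice x n) (sym (+-identityʳ i))
drop-slice i (suc a) zero    = refl
drop-slice i (suc a) (suc n) = trans (drop-slice (suc i) a n) (cong (λ x → slice x (n ∸ a)) (sym (+-suc i a)))

slice-cong : ∀ i i′ n → (∀ j → j < n → t (i + j) ≡ t (i′ + j)) → slice i n ≡ slice i′ n
slice-cong i i′ zero    _  = refl
slice-cong i i′ (suc n) eq = cong₂ _∷_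
  (trans (cong t (sym (+-identityʳ i))) (trans (eq 0 (s≤s z≤n)) (cong t (+-identityʳ i′))))
  (slice-cong (suc i) (suc i′) n λ j j<n →
    trans (cong t (sym (+-suc i j))) (trans (eq (suc j) (s≤s j<n)) (cong t (+-suc i′ j))))

slice-cong⁻ : ∀ {i i′ n} → slice i n ≡ slice i′ n → ∀ {j} → j < n → t (i + j) ≡ t (i′ + j)
slice-cong⁻ {i} {i′} eq j<n = trans (sym (nth-slice i j<n)) (trans (cong (λ w → nth w _) eq) (nth-slice i′ j<n))

slice≡take-drop : ∀ (w : Word) i r n → r + n ≤ length w →
  (∀ j → j < n → t (i + j) ≡ nth w (r + j)) → slice i n ≡ take n (drop r w)
slice≡take-drop w i r zero    _       _  = refl
slice≡take-drop w i r (suc n) r+n<w eq = begin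
  t i ∷ slice (suc i) n               ≡⟨ cong₂ _∷_ head tail ⟩
  nth w r ∷ take n (drop (suc r) w)   ≡⟨ cong (take (suc n)) (drop≡nth∷drop w (<-≤-trans (m<m+n r (s≤s z≤n)) r+n<w)) ⟨
  take (suc n) (drop r w)             ∎
  where
  open ≡-Reasoning
  head : t i ≡ nth w r
  head = trans (cong t (sym (+-identityʳ i))) (trans (eq 0 (s≤s z≤n)) (cong (nth w) (+-identityʳ r)))
  tail : slice (suc i) n ≡ take n (drop (suc r) w)
  tail = slice≡take-drop w (suc i) (suc r) n (subst (_≤ length w) (+-suc r n) r+n<w) λ j j<n →
    trans (cong t (sym (+-suc i j))) (trans (eq (suc j) (s≤s j<n)) (cong (nth w) (+-suc r j)))

-- By t-block, t is the concatenation of the blocks map (t q xor_) (μ^ k), so a factor of length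
-- at most 2 ^ k lies within two consecutive ones.
block : ℕ → Bool → Bool → Word
block k a b = map (a xor_) (μ^ k) ++ map (b xor_) (μ^ k)

length-map-μ^ : ∀ (f : Bool → Bool) k → length (map f (μ^ k)) ≡ 2 ^ k
length-map-μ^ f k = trans (length-map f (μ^ k)) (length-μ^ k)

length-block : ∀ k a b → length (block k a b) ≡ 2 ^ k + 2 ^ k
length-block k a b = trans (length-++ (map (a xor_) (μ^ k))) (cong₂ _+_ (length-map-μ^ _ k) (length-map-μ^ _ k))

nth-block-ˡ : ∀ k a b {j} → j < 2 ^ k → nth (block k a b) j ≡ a xor t j
nth-block-ˡ k a b {j} j<2^k = begin
  nth (block k a b) j          ≡⟨ nth-++ˡ (map (a xor_) (μ^ k)) _ (subst (j <_) (sym (length-map-μ^ _ k)) j<2^k) ⟩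
  nth (map (a xor_) (μ^ k)) j  ≡⟨ nth-map (a xor_) (μ^ k) (subst (j <_) (sym (length-μ^ k)) j<2^k) ⟩
  a xor nth (μ^ k) j           ≡⟨ cong (a xor_) (t≡nth-μ^ k j<2^k) ⟨
  a xor t j                    ∎
  where open ≡-Reasoning

nth-block-ʳ : ∀ k a b {j} → j < 2 ^ k → nth (block k a b) (2 ^ k + j) ≡ b xor t j
nth-block-ʳ k a b {j} j<2^k = begin
  nth (block k a b) (2 ^ k + j)                                  ≡⟨ cong (λ l → nth (block k a b) (l + j)) (length-map-μ^ _ k) ⟨
  nth (block k a b) (length (map (a xor_) (μ^ k)) + j)           ≡⟨ nth-++ʳ (map (a xor_) (μ^ k)) _ j ⟩
  nth (map (b xor_) (μ^ k)) j                                    ≡⟨ nth-map (b xor_) (μ^ k) (subst (j <_) (sym (length-μ^ k)) j<2^k) ⟩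
  b xor nth (μ^ k) j                                             ≡⟨ cong (b xor_) (t≡nth-μ^ k j<2^k) ⟨
  b xor t j                                                      ∎
  where open ≡-Reasoning

t-in-block : ∀ k q s → s < 2 ^ k + 2 ^ k → t (s + q * 2 ^ k) ≡ nth (block k (t q) (t (suc q))) s
t-in-block k q s s<2^k+2^k with s <? 2 ^ k
... | yes s<2^k = trans (t-block k q s s<2^k) (sym (nth-block-ˡ k (t q) (t (suc q)) s<2^k))
... | no s≮2^k = begin
  t (s + q * 2 ^ k)             ≡⟨ cong t s+q2^k≡ ⟩
  t (s′ + suc q * 2 ^ k)        ≡⟨ t-block k (suc q) s′ s′<2^k ⟩
  t (suc q) xor t s′            ≡⟨ nth-block-ʳ k (t q) (t (suc q)) s′<2^k ⟨
  nth w (2 ^ k + s′)            ≡⟨ cong (nth w) (m+[n∸m]≡n 2^k≤s) ⟩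
  nth w s                       ∎
  where
  open ≡-Reasoning
  w = block k (t q) (t (suc q))
  2^k≤s : 2 ^ k ≤ s
  2^k≤s = ≮⇒≥ s≮2^k
  s′ : ℕ
  s′ = s ∸ 2 ^ k
  s′<2^k : s′ < 2 ^ k
  s′<2^k = +-cancelˡ-< (2 ^ k) s′ (2 ^ k) (subst (_< 2 ^ k + 2 ^ k) (sym (m+[n∸m]≡n 2^k≤s)) s<2^k+2^k)
  s+q2^k≡ : s + q * 2 ^ k ≡ s′ + suc q * 2 ^ k
  s+q2^k≡ = begin
    s + q * 2 ^ k                ≡⟨ cong (_+ q * 2 ^ k) (m+[n∸m]≡n 2^k≤s) ⟨
    2 ^ k + s′ + q * 2 ^ k       ≡⟨ solve 3 (λ a s b → a :+ s :+ b := s :+ (a :+ b)) refl (2 ^ k) s′ (q * 2 ^ k) ⟩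
    s′ + suc q * 2 ^ k           ∎

slice-in-block : ∀ k i n → n ≤ 2 ^ k →
  ∃₂ λ q r → r < 2 ^ k × slice i n ≡ take n (drop r (block k (t q) (t (suc q))))
slice-in-block k i n n≤2^k = q , r , r<2^k ,
  slice≡take-drop (block k (t q) (t (suc q))) i r n (subst (r + n ≤_) (sym (length-block k (t q) (t (suc q)))) r+n≤)
    λ j j<n → trans (cong t (i+j≡ j)) (t-in-block k q (r + j) (<-≤-trans (+-monoʳ-< r j<n) r+n≤))
  where
  instance
    2^k≢0 : NonZero (2 ^ k)
    2^k≢0 = m^n≢0 2 k
  q r : ℕ
  q = i / 2 ^ k
  r = i % 2 ^ k
  r<2^k : r < 2 ^ k
  r<2^k = m%n<n i (2 ^ k)
  r+n≤ : r + n ≤ 2 ^ k + 2 ^ k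
  r+n≤ = +-mono-≤ (<⇒≤ r<2^k) n≤2^k
  i+j≡ : ∀ j → i + j ≡ r + j + q * 2 ^ k
  i+j≡ j = trans (cong (_+ j) (m≡m%n+[m/n]*n i (2 ^ k))) (solve 3 (λ r a j → r :+ a :+ j := r :+ j :+ a) refl r (q * 2 ^ k) j)

FactorsOfBlocks : (Word → Set) → ℕ → ℕ → Set
FactorsOfBlocks P k n = All (λ r → All (λ a → All (λ b → P (take n (drop r (block k a b)))) bits) bits) (upTo (2 ^ k))

factorsOfBlocks? : ∀ {P} → Decidable P → ∀ k n → Dec (FactorsOfBlocks P k n)
factorsOfBlocks? P? k n = all? (λ r → all? (λ a → all? (λ b → P? (take n (drop r (block k a b)))) bits) bits) (upTo (2 ^ k))

factorsOfBlocks⇒slices : ∀ P k {n} → n ≤ 2 ^ k → FactorsOfBlocks P k n → ∀ i → P (slice i n)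
factorsOfBlocks⇒slices P k {n} n≤2^k ok i with slice-in-block k i n n≤2^k
... | q , r , r<2^k , eq =
  subst P (sym eq) (lookup (lookup (lookup ok (∈-upTo⁺ r<2^k)) (∈-bits (t q))) (∈-bits (t (suc q))))

-- Occurrences and complete first returns

≟b⇒≡ : ∀ {a b} → T (a ≟b b) → a ≡ b
≟b⇒≡ {false} {false} _ = refl
≟b⇒≡ {true}  {true}  _ = refl

isPrefix-++ : ∀ u v → T (isPrefix u (u ++ v))
isPrefix-++ []          v = _
isPrefix-++ (false ∷ u) v = isPrefix-++ u v
isPrefix-++ (true ∷ u)  v = isPrefix-++ u v

isPrefix-slice⁺ : ∀ {u} i {c n} → length u ≡ c → c ≤ n → slice i c ≡ u → T (isPrefix u (slice i n))
isPrefix-slice⁺ {u} i {c} {n} refl c≤n eq = subst (λ w → T (isPrefix u w)) (sym split) (isPrefix-++ u _)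
  where
  split : slice i n ≡ u ++ slice (i + c) (n ∸ c)
  split = trans (cong (slice i) (sym (m+[n∸m]≡n c≤n)))
                (trans (slice-++ i c (n ∸ c)) (cong (_++ slice (i + c) (n ∸ c)) eq))

isPrefix-slice⁻ : ∀ u i n → T (isPrefix u (slice i n)) → slice i (length u) ≡ u
isPrefix-slice⁻ []      i n       _ = refl
isPrefix-slice⁻ (a ∷ u) i (suc n) h with a ≟b t i in a≟t
... | true = cong₂ _∷_ (sym (≟b⇒≡ (subst T (sym a≟t) _))) (isPrefix-slice⁻ u (suc i) n h)

occurs-at : ∀ {u} i {c n} j → length u ≡ c → j + c ≤ n → slice (i + j) c ≡ u → T (isPrefix u (drop j (slice i n)))
occurs-at {u} i {c} {n} j u≡c j+c≤n eq = subst (λ w → T (isPrefix u w)) (sym (drop-slice i j n))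
  (isPrefix-slice⁺ (i + j) u≡c (m+n≤o⇒m≤o∸n c (subst (_≤ n) (+-comm j c) j+c≤n)) eq)

occ-∷ : ∀ u a w → occ u w ≤ occ u (a ∷ w)
occ-∷ u a w = m≤n+m (occ u w) _

occ-∷-prefix : ∀ u a w → T (isPrefix u (a ∷ w)) → occ u (a ∷ w) ≡ suc (occ u w)
occ-∷-prefix u a w h with isPrefix u (a ∷ w)
... | true = refl

occ-drop : ∀ u j w → occ u (drop j w) ≤ occ u w
occ-drop u zero    w       = ≤-refl
occ-drop u (suc j) []      = ≤-refl
occ-drop u (suc j) (a ∷ w) = ≤-trans (occ-drop u j w) (occ-∷ u a w)

1≤occ : ∀ u w → T (isPrefix u w) → 1 ≤ occ u w
1≤occ u []      h with isPrefix u []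
... | true = ≤-refl
1≤occ u (a ∷ w) h = subst (1 ≤_) (sym (occ-∷-prefix u a w h)) (s≤s z≤n)

2≤occ : ∀ u w {j k} → j < k → k ≤ length w →
  T (isPrefix u (drop j w)) → T (isPrefix u (drop k w)) → 2 ≤ occ u w
2≤occ u (a ∷ w) {zero}  {suc k} _         _         at-j at-k =
  subst (2 ≤_) (sym (occ-∷-prefix u a w at-j)) (s≤s (≤-trans (1≤occ u (drop k w) at-k) (occ-drop u k w)))
2≤occ u (a ∷ w) {suc j} {suc k} (s≤s j<k) (s≤s k≤w) at-j at-k = ≤-trans (2≤occ u w j<k k≤w at-j at-k) (occ-∷ u a w)

3≤occ : ∀ u w {j k} → 0 < j → j < k → k ≤ length w →
  T (isPrefix u w) → T (isPrefix u (drop j w)) → T (isPrefix u (drop k w)) → 3 ≤ occ u w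
3≤occ u (a ∷ w) {suc j} {suc k} _ (s≤s j<k) (s≤s k≤w) at-0 at-j at-k =
  subst (3 ≤_) (sym (occ-∷-prefix u a w at-0)) (s≤s (2≤occ u w j<k k≤w at-j at-k))

occ-[] : ∀ w → occ [] w ≡ suc (length w)
occ-[] []      = refl
occ-[] (a ∷ w) = cong suc (occ-[] w)

privileged-return : ∀ {w} → Privileged w → 2 ≤ length w →
  ∃ λ u → Privileged u × 0 < length u × length u < length w × CompleteFirstReturn u w
privileged-return (priv-letter a) (s≤s ())
privileged-return (priv-return {[]} {w} _ _ (_ , _ , twice)) 2≤w =
  ⊥-elim (<-irrefl (sym (suc-injective (trans (sym (occ-[] w)) twice))) 2≤w)
privileged-return (priv-return {a ∷ u} pu u<w ret) _ = a ∷ u , pu , s≤s z≤n , u<w , ret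

record ReturnSlice (i c n : ℕ) : Set where
  field
    c<n    : c < n
    suffix : slice (i + (n ∸ c)) c ≡ slice i c
    twice  : occ (slice i c) (slice i n) ≡ 2

privileged-slice-return : ∀ i n → Privileged (slice i n) → 2 ≤ n →
  ∃ λ c → 0 < c × Privileged (slice i c) × ReturnSlice i c n
privileged-slice-return i n priv 2≤n
  with privileged-return priv (subst (2 ≤_) (sym (length-slice i n)) 2≤n)
... | u , pu , 0<u , u<w , (s , w≡us) , (s′ , w≡s′u) , twice =
  c , 0<u , subst Privileged u≡slice pu ,
  record { c<n = c<n ; suffix = trans suffix u≡slice ; twice = subst (λ v → occ v (slice i n) ≡ 2) u≡slice twice }
  where
  open ≡-Reasoning
  c : ℕ
  c = length u
  c<n : c < n
  c<n = subst (c <_) (length-slice i n) u<w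
  u≡slice : u ≡ slice i c
  u≡slice = begin
    u                       ≡⟨ take-length-++ u s ⟨
    take c (u ++ s)         ≡⟨ cong (take c) w≡us ⟨
    take c (slice i n)      ≡⟨ take-slice i (<⇒≤ c<n) ⟩
    slice i c               ∎
  s′≡n∸c : length s′ ≡ n ∸ c
  s′≡n∸c = begin
    length s′               ≡⟨ m+n∸n≡m (length s′) c ⟨
    length s′ + c ∸ c       ≡⟨ cong (_∸ c) (length-++ s′) ⟨
    length (s′ ++ u) ∸ c    ≡⟨ cong (λ w → length w ∸ c) w≡s′u ⟨
    length (slice i n) ∸ c  ≡⟨ cong (_∸ c) (length-slice i n) ⟩
    n ∸ c                   ∎
  suffix : slice (i + (n ∸ c)) c ≡ u
  suffix = begin
    slice (i + (n ∸ c)) c             ≡⟨ cong (slice (i + (n ∸ c))) (m∸[m∸n]≡n (<⇒≤ c<n)) ⟨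
    slice (i + (n ∸ c)) (n ∸ (n ∸ c)) ≡⟨ drop-slice i (n ∸ c) n ⟨
    drop (n ∸ c) (slice i n)          ≡⟨ cong₂ drop (sym s′≡n∸c) w≡s′u ⟩
    drop (length s′) (s′ ++ u)        ≡⟨ drop-length-++ s′ u ⟩
    u                                 ∎

-- Periods

HasPeriod : ℕ → ℕ → ℕ → Set
HasPeriod i n p = ∀ j → j + p < n → t (i + j) ≡ t (i + (j + p))

HasPeriod-≤ : ∀ {i n n′ p} → n′ ≤ n → HasPeriod i n p → HasPeriod i n′ p
HasPeriod-≤ n′≤n per j j+p<n′ = per j (<-≤-trans j+p<n′ n′≤n)

period⇒slice≡ : ∀ {i n p} m → HasPeriod i n p → p + m ≤ n → slice (i + p) m ≡ slice i m
period⇒slice≡ {i} {n} {p} m per p+m≤n = slice-cong (i + p) i m λ j j<m →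
  sym (trans (per j (<-≤-trans (subst (_< p + m) (+-comm p j) (+-monoʳ-< p j<m)) p+m≤n)) (cong t (i+[j+p]≡i+p+j i j p)))

slice≡⇒period : ∀ {i p m} → slice (i + p) m ≡ slice i m → HasPeriod i (p + m) p
slice≡⇒period {i} {p} {m} eq j j+p<p+m =
  trans (sym (slice-cong⁻ eq (+-cancelʳ-< p j m (subst (j + p <_) (+-comm p m) j+p<p+m)))) (cong t (sym (i+[j+p]≡i+p+j i j p)))

commuting⇒period : ∀ {i n} (v x : Word) → slice i n ≡ v ++ x → slice i n ≡ x ++ v → HasPeriod i n (length v)
commuting⇒period {i} {n} v x w≡vx w≡xv = subst (λ m → HasPeriod i m (length v)) n≡ (slice≡⇒period shifted)
  where
  open ≡-Reasoning
  n≡ : length v + length x ≡ n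
  n≡ = trans (sym (length-++ v)) (trans (cong length (sym w≡vx)) (length-slice i n))
  shifted : slice (i + length v) (length x) ≡ slice i (length x)
  shifted = begin
    slice (i + length v) (length x)      ≡⟨ cong (slice (i + length v)) (trans (sym (m+n∸m≡n (length v) (length x))) (cong (_∸ length v) n≡)) ⟩
    slice (i + length v) (n ∸ length v)  ≡⟨ drop-slice i (length v) n ⟨
    drop (length v) (slice i n)          ≡⟨ cong (drop (length v)) w≡vx ⟩
    drop (length v) (v ++ x)             ≡⟨ drop-length-++ v x ⟩
    x                                    ≡⟨ take-length-++ x v ⟨
    take (length x) (x ++ v)             ≡⟨ cong (take (length x)) w≡xv ⟨
    take (length x) (slice i n)          ≡⟨ take-slice i (subst (length x ≤_) n≡ (m≤n+m (length x) (length v))) ⟩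
    slice i (length x)                   ∎

period-∸ : ∀ {i n d p} → HasPeriod i n d → HasPeriod i n p → d ≤ p → d + p ≤ n → HasPeriod i n (p ∸ d)
period-∸ {i} {n} {d} {p} per-d per-p d≤p d+p≤n j j+e<n with j + p <? n
... | yes j+p<n = begin
  t (i + j)                   ≡⟨ per-p j j+p<n ⟩
  t (i + (j + p))             ≡⟨ cong (λ x → t (i + x)) j+p≡ ⟩
  t (i + (j + e + d))         ≡⟨ per-d (j + e) (subst (_< n) j+p≡ j+p<n) ⟨
  t (i + (j + e))             ∎
  where
  open ≡-Reasoning
  e = p ∸ d
  j+p≡ : j + p ≡ j + e + d
  j+p≡ = trans (cong (j +_) (sym (m∸n+n≡m d≤p))) (sym (+-assoc j e d))
... | no j+p≮n = begin
  t (i + j)                   ≡⟨ cong (λ x → t (i + x)) (sym j′+d≡j) ⟩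
  t (i + (j′ + d))            ≡⟨ per-d j′ (subst (_< n) (sym j′+d≡j) (≤-<-trans (m≤m+n j e) j+e<n)) ⟨
  t (i + j′)                  ≡⟨ per-p j′ (subst (_< n) (sym j′+p≡) j+e<n) ⟩
  t (i + (j′ + p))            ≡⟨ cong (λ x → t (i + x)) j′+p≡ ⟩
  t (i + (j + e))             ∎
  where
  open ≡-Reasoning
  e = p ∸ d
  d≤j : d ≤ j
  d≤j = +-cancelʳ-≤ p d j (≤-trans d+p≤n (≮⇒≥ j+p≮n))
  j′ = j ∸ d
  j′+d≡j : j′ + d ≡ j
  j′+d≡j = m∸n+n≡m d≤j
  j′+p≡ : j′ + p ≡ j + e
  j′+p≡ = begin
    j′ + p        ≡⟨ cong (j′ +_) (m+[n∸m]≡n d≤p) ⟨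
    j′ + (d + e)  ≡⟨ +-assoc j′ d e ⟨
    j′ + d + e    ≡⟨ cong (_+ e) j′+d≡j ⟩
    j + e         ∎

fine-wilf : ∀ {i n d p} → HasPeriod i n d → HasPeriod i n p → 0 < d → 0 < p → d + p ≤ n →
  ∃ λ g → 0 < g × g ∣ d × g ∣ p × HasPeriod i n g
fine-wilf {i} {n} = go (<-wellFounded _)
  where
  go : ∀ {d p} → Acc _<_ (d + p) → HasPeriod i n d → HasPeriod i n p → 0 < d → 0 < p → d + p ≤ n →
    ∃ λ g → 0 < g × g ∣ d × g ∣ p × HasPeriod i n g
  go {d} {p} (acc rec) per-d per-p 0<d 0<p d+p≤n with <-cmp d p
  ... | tri≈ _ refl _ = d , 0<d , ∣-refl , ∣-refl , per-d
  ... | tri< d<p _ _ with go (rec (+-monoʳ-< d (∸-monoʳ-< 0<d (<⇒≤ d<p)))) per-d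
                             (period-∸ {i} per-d per-p (<⇒≤ d<p) d+p≤n) 0<d (m<n⇒0<n∸m d<p)
                             (≤-trans (+-monoʳ-≤ d (m∸n≤m p d)) d+p≤n)
  ...   | g , 0<g , g∣d , g∣p∸d , per-g = g , 0<g , g∣d , ∣m∸n∣n⇒∣m g (<⇒≤ d<p) g∣p∸d g∣d , per-g
  go {d} {p} (acc rec) per-d per-p 0<d 0<p d+p≤n | tri> _ _ p<d
    with go (rec (subst (p + (d ∸ p) <_) (+-comm p d) (+-monoʳ-< p (∸-monoʳ-< 0<p (<⇒≤ p<d))))) per-p
            (period-∸ {i} per-p per-d (<⇒≤ p<d) (subst (_≤ n) (+-comm d p) d+p≤n)) 0<p (m<n⇒0<n∸m p<d)
            (≤-trans (+-monoʳ-≤ p (m∸n≤m d p)) (subst (_≤ n) (+-comm d p) d+p≤n))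
  ... | g , 0<g , g∣p , g∣d∸p , per-g = g , 0<g , ∣m∸n∣n⇒∣m g (<⇒≤ p<d) g∣d∸p g∣p , g∣p , per-g

module _ {i c n} (ret : ReturnSlice i c n) where
  open ReturnSlice ret

  return-period : HasPeriod i n (n ∸ c)
  return-period = subst (λ m → HasPeriod i m (n ∸ c)) (m∸n+n≡m (<⇒≤ c<n)) (slice≡⇒period suffix)

  return-no-inner-occurrence : ∀ {j} → 0 < j → j + c < n → slice (i + j) c ≢ slice i c
  return-no-inner-occurrence {j} 0<j j+c<n eq = <-irrefl refl (subst (3 ≤_) twice three)
    where
    u = slice i c
    three : 3 ≤ occ u (slice i n)
    three = 3≤occ u (slice i n) 0<j (m+n≤o⇒m≤o∸n (suc j) j+c<n)
      (subst (n ∸ c ≤_) (sym (length-slice i n)) (m∸n≤m n c))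
      (occurs-at i 0 (length-slice i c) (<⇒≤ c<n) (cong (λ x → slice x c) (+-identityʳ i)))
      (occurs-at i j (length-slice i c) (<⇒≤ j+c<n) eq)
      (occurs-at i (n ∸ c) (length-slice i c) (≤-reflexive (m∸n+n≡m (<⇒≤ c<n))) suffix)

  return-period-minimal : ∀ {q} → HasPeriod i n q → 0 < q → n ∸ c ≤ q
  return-period-minimal {q} per 0<q = m≤n+o⇒m∸n≤o n c (subst (n ≤_) (+-comm q c) (≮⇒≥ λ q+c<n →
    return-no-inner-occurrence 0<q q+c<n (period⇒slice≡ c per (<⇒≤ q+c<n))))

  return-period-∣ : ∀ {p} → HasPeriod i n p → 0 < p → p + p ≤ n → n ∸ c ∣ p
  return-period-∣ {p} per-p 0<p p+p≤n
    with fine-wilf {i} return-period per-p 0<d 0<p (≤-trans (+-monoˡ-≤ p (return-period-minimal per-p 0<p)) p+p≤n)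
    where
    0<d : 0 < n ∸ c
    0<d = m<n⇒0<n∸m c<n
  ... | g , 0<g , g∣d , g∣p , per-g = subst (_∣ p) g≡d g∣p
    where
    g≡d : g ≡ n ∸ c
    g≡d = ≤-antisym (∣⇒≤ {{>-nonZero (m<n⇒0<n∸m c<n)}} g∣d) (return-period-minimal per-g 0<g)

-- Finite checks

squareRoots : List Word
squareRoots =
  (𝟎 ∷ []) ∷ (𝟏 ∷ []) ∷ (𝟎 ∷ 𝟏 ∷ 𝟎 ∷ []) ∷ (𝟏 ∷ 𝟎 ∷ 𝟏 ∷ []) ∷ (𝟎 ∷ 𝟏 ∷ 𝟏 ∷ 𝟎 ∷ []) ∷ (𝟏 ∷ 𝟎 ∷ 𝟎 ∷ 𝟏 ∷ []) ∷
  (𝟎 ∷ 𝟏 ∷ 𝟏 ∷ 𝟎 ∷ 𝟏 ∷ 𝟎 ∷ 𝟎 ∷ 𝟏 ∷ 𝟎 ∷ 𝟏 ∷ 𝟏 ∷ 𝟎 ∷ []) ∷ (𝟏 ∷ 𝟎 ∷ 𝟎 ∷ 𝟏 ∷ 𝟎 ∷ 𝟏 ∷ 𝟏 ∷ 𝟎 ∷ 𝟏 ∷ 𝟎 ∷ 𝟎 ∷ 𝟏 ∷ []) ∷ []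

length-squareRoots : ∀ {y} → y ∈ squareRoots → length y ≤ 12
length-squareRoots = lookup (toWitness {a? = all? (λ y → length y ≤? 12) squareRoots} _)

Cube : ℕ → Word → Set
Cube d z = drop d z ≡ take (d + d) z

cube-free : ∀ i d → 0 < d → d ≤ 12 → ¬ HasPeriod i (d + (d + d)) d
cube-free i (suc d′) _ d≤12 per = noCube (begin
  drop d (slice i (d + (d + d)))   ≡⟨ drop-slice i d (d + (d + d)) ⟩
  slice (i + d) (d + (d + d) ∸ d)  ≡⟨ cong (slice (i + d)) (m+n∸m≡n d (d + d)) ⟩
  slice (i + d) (d + d)            ≡⟨ period⇒slice≡ (d + d) per ≤-refl ⟩
  slice i (d + d)                  ≡⟨ take-slice i (m≤n+m (d + d) d) ⟨
  take (d + d) (slice i (d + (d + d))) ∎)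
  where
  open ≡-Reasoning
  d = suc d′
  checked : All (λ d′ → FactorsOfBlocks (λ z → ¬ Cube (suc d′) z) 6 (suc d′ + (suc d′ + suc d′))) (upTo 12)
  checked = toWitness {a? = all? (λ d′ → factorsOfBlocks? (λ z → ¬? (drop (suc d′) z ≟ʷ take (suc d′ + suc d′) z)) 6 (suc d′ + (suc d′ + suc d′))) (upTo 12)} _
  d+2d≤2^6 : d + (d + d) ≤ 2 ^ 6
  d+2d≤2^6 = ≤-trans (+-mono-≤ d≤12 (+-mono-≤ d≤12 d≤12)) (m≤m+n 36 28)
  noCube : ¬ Cube d (slice i (d + (d + d)))
  noCube = factorsOfBlocks⇒slices (λ z → ¬ Cube d z) 6 d+2d≤2^6 (lookup checked (∈-upTo⁺ d≤12)) i

OccursWithin : Word → ℕ → Word → Set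
OccursWithin u G z = Any (λ j → T (isPrefix u (drop j z))) (applyUpTo suc G)

occursWithin? : ∀ u G → Decidable (OccursWithin u G)
occursWithin? u G z = any? (λ j → T? (isPrefix u (drop j z))) (applyUpTo suc G)

SquareOfReturn : Word → ℕ → Word → Set
SquareOfReturn u m z =
  T (isPrefix u (take m z)) → occ u (take m z) ≡ 2 → drop m z ≡ take m z → take m z ∈ squareRoots

squareOfReturn? : ∀ u m → Decidable (SquareOfReturn u m)
squareOfReturn? u m z =
  T? _ →-dec (occ u (take m z) ≟ 2 →-dec (drop m z ≟ʷ take m z →-dec (take m z ∈? squareRoots)))

SquareRootsReturningTo : Word → Set
SquareRootsReturningTo u =
  ∀ {i c m} → slice i c ≡ u → ReturnSlice i c m → slice (i + m) m ≡ slice i m → slice i m ∈ squareRoots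

-- G bounds the gaps between occurrences of u in t, hence the length of a complete first return to u;
-- the squares of all such returns are then enumerated.
squareRootsReturningTo-check : ∀ u G kc ke →
  let L = G + length u in
  True (L ≤? 2 ^ kc) → True (factorsOfBlocks? (occursWithin? u G) kc L) →
  True (L + L ≤? 2 ^ ke) → True (all? (λ m → factorsOfBlocks? (squareOfReturn? u m) ke (m + m)) (upTo (suc L))) →
  SquareRootsReturningTo u
squareRootsReturningTo-check u G kc ke L≤ occurs 2L≤ squares {i} {c} {m} refl ret square =
  subst (_∈ squareRoots) (take-slice i (m≤m+n m m))
    (squareAt (subst (λ w → T (isPrefix u w)) (sym (take-slice i (m≤m+n m m))) u-prefix)
              (subst (λ w → occ u w ≡ 2) (sym (take-slice i (m≤m+n m m))) twice)
              (begin
                drop m (slice i (m + m))  ≡⟨ drop-slice i m (m + m) ⟩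
                slice (i + m) (m + m ∸ m) ≡⟨ cong (slice (i + m)) (m+n∸m≡n m m) ⟩
                slice (i + m) m           ≡⟨ square ⟩
                slice i m                 ≡⟨ take-slice i (m≤m+n m m) ⟨
                take m (slice i (m + m))  ∎))
  where
  open ≡-Reasoning
  open ReturnSlice ret
  |u|≡c : length u ≡ c
  |u|≡c = length-slice i c
  L = G + length u
  recurrence : ∃ λ j → 0 < j × j ≤ G × slice (i + j) c ≡ u
  recurrence with find (factorsOfBlocks⇒slices (OccursWithin (slice i c) G) kc (toWitness L≤) (toWitness occurs) i)
  ... | j , j∈ , at-j with ∈-applyUpTo⁻ suc j∈
  ...   | j′ , j′<G , refl = suc j′ , s≤s z≤n , j′<G ,
    subst (λ x → slice (i + suc j′) x ≡ u) |u|≡c (isPrefix-slice⁻ u (i + suc j′) (L ∸ suc j′)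
      (subst (λ w → T (isPrefix u w)) (drop-slice i (suc j′) L) at-j))
  m≤L : m ≤ L
  m≤L with recurrence
  ... | j , 0<j , j≤G , at-j = ≮⇒≥ λ L<m →
    return-no-inner-occurrence ret 0<j (≤-<-trans (+-mono-≤ j≤G (≤-reflexive (sym |u|≡c))) L<m) at-j
  u-prefix : T (isPrefix u (slice i m))
  u-prefix = isPrefix-slice⁺ i |u|≡c (<⇒≤ c<n) refl
  squareAt : SquareOfReturn u m (slice i (m + m))
  squareAt = factorsOfBlocks⇒slices (SquareOfReturn (slice i c) m) ke (≤-trans (+-mono-≤ m≤L m≤L) (toWitness 2L≤))
    (lookup (toWitness squares) (∈-upTo⁺ (s≤s m≤L))) i

squareRoots-return : ∀ {u} → u ∈ squareRoots → SquareRootsReturningTo u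
squareRoots-return (here refl)                                                           = squareRootsReturningTo-check _ 3 2 3 _ _ _ _
squareRoots-return (there (here refl))                                                   = squareRootsReturningTo-check _ 3 2 3 _ _ _ _
squareRoots-return (there (there (here refl)))                                           = squareRootsReturningTo-check _ 9 4 5 _ _ _ _
squareRoots-return (there (there (there (here refl))))                                   = squareRootsReturningTo-check _ 9 4 5 _ _ _ _
squareRoots-return (there (there (there (there (here refl)))))                           = squareRootsReturningTo-check _ 8 4 5 _ _ _ _
squareRoots-return (there (there (there (there (there (here refl))))))                   = squareRootsReturningTo-check _ 8 4 5 _ _ _ _
squareRoots-return (there (there (there (there (there (there (here refl)))))))           = squareRootsReturningTo-check _ 36 6 7 _ _ _ _
squareRoots-return (there (there (there (there (there (there (there (here refl))))))))   = squareRootsReturningTo-check _ 36 6 7 _ _ _ _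

privileged-square-root : ∀ m i → 0 < m → Privileged (slice i m) → slice (i + m) m ≡ slice i m → slice i m ∈ squareRoots
privileged-square-root m = go m (<-wellFounded m)
  where
  go : ∀ m → Acc _<_ m → ∀ i → 0 < m → Privileged (slice i m) → slice (i + m) m ≡ slice i m → slice i m ∈ squareRoots
  go (suc zero) _ i _ _ _ with t i
  ... | false = here refl
  ... | true  = there (here refl)
  -- The occurrence of the border at the end of the root is followed by the border again, as a prefix of
  -- the second copy of the root.
  go m@(suc (suc _)) (acc rec) i _ priv square
    with privileged-slice-return i m priv (s≤s (s≤s z≤n))
  ... | c , 0<c , priv-c , ret =
    squareRoots-return (subst (_∈ squareRoots) suffix root-of-suffix) refl ret square
    where
    open ReturnSlice ret
    open ≡-Reasoning
    i′ = i + (m ∸ c)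
    c≤m : c ≤ m
    c≤m = <⇒≤ c<n
    square′ : slice (i′ + c) c ≡ slice i′ c
    square′ = begin
      slice (i′ + c) c           ≡⟨ cong (λ x → slice x c) (trans (+-assoc i (m ∸ c) c) (cong (i +_) (m∸n+n≡m c≤m))) ⟩
      slice (i + m) c            ≡⟨ take-slice (i + m) c≤m ⟨
      take c (slice (i + m) m)   ≡⟨ cong (take c) square ⟩
      take c (slice i m)         ≡⟨ take-slice i c≤m ⟩
      slice i c                  ≡⟨ suffix ⟨
      slice i′ c                 ∎
    root-of-suffix : slice i′ c ∈ squareRoots
    root-of-suffix = go c (rec c<n) i′ 0<c (subst Privileged (sym suffix) priv-c) square′

privileged-periodic⇒square : ∀ n i {p} → Privileged (slice i n) → HasPeriod i n p → 0 < p → p + p ≤ n → p ∣ n →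
  ∃ λ y → y ∈ squareRoots × slice i n ≡ y ²
privileged-periodic⇒square n = go n (<-wellFounded n)
  where
  go : ∀ n → Acc _<_ n → ∀ i {p} → Privileged (slice i n) → HasPeriod i n p → 0 < p → p + p ≤ n → p ∣ n →
    ∃ λ y → y ∈ squareRoots × slice i n ≡ y ²
  go n (acc rec) i {p} priv per-p 0<p p+p≤n p∣n
    with privileged-slice-return i n priv (≤-trans (+-mono-≤ 0<p 0<p) p+p≤n)
  ... | c , 0<c , priv-c , ret = by-cases (<-cmp c d)
    where
    open ReturnSlice ret
    d = n ∸ c
    d+c≡n : d + c ≡ n
    d+c≡n = m∸n+n≡m (<⇒≤ c<n)
    0<d : 0 < d
    0<d = m<n⇒0<n∸m c<n
    per-d : HasPeriod i n d
    per-d = return-period ret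
    d∣n : d ∣ n
    d∣n = ∣-trans (return-period-∣ ret per-p 0<p p+p≤n) p∣n
    d∣c : d ∣ c
    d∣c = ∣m+n∣m⇒∣n (subst (d ∣_) (sym d+c≡n) d∣n) ∣-refl
    by-cases : Tri (c < d) (c ≡ d) (d < c) → ∃ λ y → y ∈ squareRoots × slice i n ≡ y ²
    by-cases (tri< c<d _ _) = ⊥-elim (<⇒≱ c<d (∣⇒≤ {{>-nonZero 0<c}} d∣c))
    by-cases (tri≈ _ c≡d _) = slice i c , privileged-square-root c i 0<c priv-c square ,
      trans (cong (slice i) (trans (sym d+c≡n) (cong (_+ c) (sym c≡d)))) (slice-² square)
      where
      square : slice (i + c) c ≡ slice i c
      square = subst (λ x → slice (i + x) c ≡ slice i c) (sym c≡d) suffix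
    by-cases (tri> _ _ d<c) =
      ⊥-elim (no-cube (go c (rec c<n) i priv-c (HasPeriod-≤ {i} (<⇒≤ c<n) per-d) 0<d d+d≤c d∣c))
      where
      d+d≤c : d + d ≤ c
      d+d≤c = m∣n∧m<n⇒m+m≤n d∣c d<c
      3d≤n : d + (d + d) ≤ n
      3d≤n = subst (d + (d + d) ≤_) d+c≡n (+-monoʳ-≤ d d+d≤c)
      no-cube : ∄ λ y → y ∈ squareRoots × slice i c ≡ y ²
      no-cube (y , y∈ , c≡y²) = cube-free i d 0<d (≤-trans d≤y (length-squareRoots y∈)) (HasPeriod-≤ {i} 3d≤n per-d)
        where
        d≤y : d ≤ length y
        d≤y = m+m≤n+n⇒m≤n (subst (d + d ≤_) (trans (sym (length-slice i c)) (trans (cong length c≡y²) (length-++ y))) d+d≤c)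

privileged-power⇒square : ∀ {w} v k → Factor w → Privileged w → 0 < length v → 2 ≤ k → w ≡ concat (replicate k v) →
  ∃ λ y → y ∈ squareRoots × w ≡ y ²
privileged-power⇒square {w} v (suc k) (i , w≡factor) priv 0<v (s≤s 1≤k) w≡vᵏ =
  map₂ (map₂ (trans w≡slice)) (privileged-periodic⇒square n i (subst Privileged w≡slice priv) period 0<v v+v≤n (divides (suc k) n≡))
  where
  n = length w
  x = concat (replicate k v)
  w≡slice : w ≡ slice i n
  w≡slice = trans w≡factor (factor≡slice i n)
  period : HasPeriod i n (length v)
  period = commuting⇒period v x (trans (sym w≡slice) w≡vᵏ)
    (trans (sym w≡slice) (trans w≡vᵏ (sym (concat-replicate-comm k v))))
  n≡ : n ≡ suc k * length v
  n≡ = trans (cong length w≡vᵏ) (length-concat-replicate (suc k) v)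
  v+v≤n : length v + length v ≤ n
  v+v≤n = subst (length v + length v ≤_) (sym n≡)
    (+-monoʳ-≤ (length v) (≤-trans (≤-reflexive (sym (*-identityˡ (length v)))) (*-monoˡ-≤ (length v) 1≤k)))

ListedSquare : Word → Set
ListedSquare w =
  w ≡ (𝟎 ∷ []) ² ⊎ w ≡ (𝟎 ∷ 𝟏 ∷ 𝟎 ∷ []) ² ⊎ w ≡ (𝟎 ∷ 𝟏 ∷ 𝟏 ∷ 𝟎 ∷ []) ²
  ⊎ w ≡ (𝟎 ∷ 𝟏 ∷ 𝟏 ∷ 𝟎 ∷ 𝟏 ∷ 𝟎 ∷ 𝟎 ∷ 𝟏 ∷ 𝟎 ∷ 𝟏 ∷ 𝟏 ∷ 𝟎 ∷ []) ²

listedSquare? : Decidable ListedSquare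
listedSquare? w = w ≟ʷ _ ⊎-dec w ≟ʷ _ ⊎-dec w ≟ʷ _ ⊎-dec w ≟ʷ _

squareRoot-𝟎⇒listed : ∀ {y u} → y ∈ squareRoots → y ² ≡ 𝟎 ∷ u → ListedSquare (y ²)
squareRoot-𝟎⇒listed (here refl)                                                         _ = inj₁ refl
squareRoot-𝟎⇒listed (there (here refl))                                                 ()
squareRoot-𝟎⇒listed (there (there (here refl)))                                         _ = inj₂ (inj₁ refl)
squareRoot-𝟎⇒listed (there (there (there (here refl))))                                 ()
squareRoot-𝟎⇒listed (there (there (there (there (here refl)))))                         _ = inj₂ (inj₂ (inj₁ refl))
squareRoot-𝟎⇒listed (there (there (there (there (there (here refl))))))                 ()
squareRoot-𝟎⇒listed (there (there (there (there (there (there (here refl)))))))         _ = inj₂ (inj₂ (inj₂ refl))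
squareRoot-𝟎⇒listed (there (there (there (there (there (there (there (here refl)))))))) ()

nonprimitive-privileged-factor⇒listed : ∀ w →
  Factor w × Privileged w × (∃ λ u → w ≡ 𝟎 ∷ u) × ¬ Primitive w → ListedSquare w
nonprimitive-privileged-factor⇒listed w (factor , priv , (u , refl) , not-primitive) =
  -- ¬ Primitive w is only the double negation of w being a power; the conclusion is decidable, hence stable.
  decidable-stable (listedSquare? w) λ not-listed → not-primitive ((λ ()) , λ (v , k , 2≤k , w≡vᵏ) → not-listed (power v k 2≤k w≡vᵏ))
  where
  power : ∀ v k → 2 ≤ k → w ≡ concat (replicate k v) → ListedSquare w
  power []      k _   w≡vᵏ with () ← trans w≡vᵏ (concat-replicate-[] k)
  power (a ∷ v) k 2≤k w≡vᵏ with privileged-power⇒square (a ∷ v) k factor priv (s≤s z≤n) 2≤k w≡vᵏ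
  ... | y , y∈ , w≡y² = subst ListedSquare (sym w≡y²) (squareRoot-𝟎⇒listed y∈ (sym w≡y²))

square-nonprimitive : ∀ y → ¬ Primitive (y ²)
square-nonprimitive y (_ , not-power) = not-power (y , 2 , ≤-refl , cong (y ++_) (sym (++-identityʳ y)))

privileged-0 : Privileged (𝟎 ∷ [])
privileged-0 = priv-letter 𝟎

privileged-010 : Privileged (𝟎 ∷ 𝟏 ∷ 𝟎 ∷ [])
privileged-010 = priv-return privileged-0 (≤ᵇ⇒≤ _ _ _) ((_ , refl) , (𝟎 ∷ 𝟏 ∷ [] , refl) , refl)

privileged-0110 : Privileged (𝟎 ∷ 𝟏 ∷ 𝟏 ∷ 𝟎 ∷ [])
privileged-0110 = priv-return privileged-0 (≤ᵇ⇒≤ _ _ _) ((_ , refl) , (𝟎 ∷ 𝟏 ∷ 𝟏 ∷ [] , refl) , refl)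

privileged-011010010110 : Privileged (𝟎 ∷ 𝟏 ∷ 𝟏 ∷ 𝟎 ∷ 𝟏 ∷ 𝟎 ∷ 𝟎 ∷ 𝟏 ∷ 𝟎 ∷ 𝟏 ∷ 𝟏 ∷ 𝟎 ∷ [])
privileged-011010010110 =
  priv-return privileged-0110 (≤ᵇ⇒≤ _ _ _) ((_ , refl) , (𝟎 ∷ 𝟏 ∷ 𝟏 ∷ 𝟎 ∷ 𝟏 ∷ 𝟎 ∷ 𝟎 ∷ 𝟏 ∷ [] , refl) , refl)

privileged-square : ∀ {y} → Privileged y → 0 < length y → occ y (y ²) ≡ 2 → Privileged (y ²)
privileged-square {y} priv 0<y twice =
  priv-return priv (subst (length y <_) (sym (length-++ y)) (m<m+n (length y) 0<y)) ((y , refl) , (y , refl) , twice)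

listed⇒nonprimitive-privileged-factor : ∀ w → ListedSquare w →
  Factor w × Privileged w × (∃ λ u → w ≡ 𝟎 ∷ u) × ¬ Primitive w
listed⇒nonprimitive-privileged-factor _ (inj₁ refl) =
  (5 , refl) , privileged-square privileged-0 (s≤s z≤n) refl , (_ , refl) , square-nonprimitive (𝟎 ∷ [])
listed⇒nonprimitive-privileged-factor _ (inj₂ (inj₁ refl)) =
  (15 , refl) , privileged-square privileged-010 (s≤s z≤n) refl , (_ , refl) , square-nonprimitive (𝟎 ∷ 𝟏 ∷ 𝟎 ∷ [])
listed⇒nonprimitive-privileged-factor _ (inj₂ (inj₂ (inj₁ refl))) =
  (20 , refl) , privileged-square privileged-0110 (s≤s z≤n) refl , (_ , refl) , square-nonprimitive (𝟎 ∷ 𝟏 ∷ 𝟏 ∷ 𝟎 ∷ [])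
listed⇒nonprimitive-privileged-factor _ (inj₂ (inj₂ (inj₂ refl))) =
  (60 , refl) , privileged-square privileged-011010010110 (s≤s z≤n) refl , (_ , refl) ,
  square-nonprimitive (𝟎 ∷ 𝟏 ∷ 𝟏 ∷ 𝟎 ∷ 𝟏 ∷ 𝟎 ∷ 𝟎 ∷ 𝟏 ∷ 𝟎 ∷ 𝟏 ∷ 𝟏 ∷ 𝟎 ∷ [])

proposition4p21 : (w : Word) →
    (Factor w × Privileged w × (∃ λ u → w ≡ 𝟎 ∷ u) × ¬ Primitive w)
    ⇔ (w ≡ 𝟎 ∷ 𝟎 ∷ []
       ⊎ w ≡ 𝟎 ∷ 𝟏 ∷ 𝟎 ∷ 𝟎 ∷ 𝟏 ∷ 𝟎 ∷ []
       ⊎ w ≡ 𝟎 ∷ 𝟏 ∷ 𝟏 ∷ 𝟎 ∷ 𝟎 ∷ 𝟏 ∷ 𝟏 ∷ 𝟎 ∷ []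
       ⊎ w ≡ (𝟎 ∷ 𝟏 ∷ 𝟏 ∷ 𝟎 ∷ 𝟏 ∷ 𝟎 ∷ 𝟎 ∷ 𝟏 ∷ 𝟎 ∷ 𝟏 ∷ 𝟏 ∷ 𝟎 ∷ []) ²)
proposition4p21 w = mk⇔ (nonprimitive-privileged-factor⇒listed w) (listed⇒nonprimitive-privileged-factor w)
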